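{- Let $(V,\mathcal{B})$ be a $(v,k,1)$-BIBD with well-distributed minimal sub-BIBDs with parameters $l,m$, whose minimal sub-BIBDs are $(v',k,1)$-BIBDs, and let $n$ be the number of minimal sub-BIBDs. Then (a) $n=m\frac{v(v-1)}{v'(v'-1)}$; (b) $l=m\frac{v-1}{v'-1}$.
   Context: A $(v,k,\lambda)$-BIBD is a pair $(V,\mathcal{B})$ where $V$ is a finite set of $v$ points and $\mathcal{B}$ is a set (no repeated blocks) of $k$-subsets of $V$, $k>1$, such that every pair of distinct points lies in exactly $\lambda$ blocks; trivial cases are excluded. A sub-BIBD of a $(v,k,1)$-BIBD $(V,\mathcal{B})$ is a pair $(V',\mathcal{B}')$ with $V'\subseteq V$, $\mathcal{B}'\subseteq\{B\in\mathcal{B}:B\subseteq V'\}$, which is itself a $(v',k,1)$-BIBD. A sub-BIBD is minimal if $v'$ is minimal among all sub-BIBDs with $v'>k$. $(V,\mathcal{B})$ has well-distributed minimal sub-BIBDs if there are integers $l,m$ such that every point lies in exactly $l$ minimal sub-BIBDs and every block lies in exactly $m$ minimal sub-BIBDs. -}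

module Defs where

open import Data.Nat using (ℕ; zero; suc; _<_; _≤_; _+_)
open import Data.Bool using (Bool; true; false; _∧_; if_then_else_)
open import Data.Fin using (Fin; zero; suc)
open import Data.Fin.Subset using (Subset; ∣_∣; _⊆_)
open import Data.Vec using (lookup)
open import Data.Product using (_×_; proj₁; proj₂)
open import Data.List using (List; length; filter)
open import Data.List.Membership.Propositional using (_∈_)
open import Data.List.Relation.Unary.Unique.Propositional using (Unique)
open import Data.Bool.Properties using (T?)
open import Data.Bool using (T)
open import Relation.Binary.PropositionalEquality using (_≡_; _≢_)
open import Function.Definitions using (Injective)
open import Function.Bundles using (_⇔_)

countFin : (n : ℕ) → (Fin n → Bool) → ℕ
countFin zero    p = 0
countFin (suc n) p = (if p zero then 1 else 0) + countFin n (λ i → p (suc i))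

-- A (v,k,λ)-BIBD on the point set Fin v with b blocks, given as an
-- injective family of k-subsets (so the set of blocks has no repeats).
-- Trivial cases excluded: 1 < k < v.
record IsBIBD (v k λ' b : ℕ) (blocks : Fin b → Subset v) : Set where
  field
    k>1        : 1 < k
    k<v        : k < v
    blockSize  : ∀ i → ∣ blocks i ∣ ≡ k
    noRepeats  : Injective _≡_ _≡_ blocks
    balanced   : ∀ (x y : Fin v) → x ≢ y →
                 countFin b (λ i → lookup (blocks i) x ∧ lookup (blocks i) y) ≡ λ'

-- A candidate sub-structure: a point set V' ⊆ V and a set B' of block indices.
SubCand : (v b : ℕ) → Set
SubCand v b = Subset v × Subset b

-- (V',B') is a sub-BIBD of the design with the given blocks: every block of
-- B' lies inside V' (blocks automatically have size k), and every pair of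
-- distinct points of V' lies in exactly one block of B'.
-- Its order is v' = ∣ V' ∣.
record IsSubBIBD {v b : ℕ} (blocks : Fin b → Subset v) (P : SubCand v b) : Set where
  field
    blocksInside : ∀ i → lookup (proj₂ P) i ≡ true → blocks i ⊆ proj₁ P
    balanced     : ∀ (x y : Fin v) → x ≢ y →
                   lookup (proj₁ P) x ≡ true → lookup (proj₁ P) y ≡ true →
                   countFin b (λ i → lookup (proj₂ P) i ∧ lookup (blocks i) x ∧ lookup (blocks i) y) ≡ 1

record IsMinimalSubBIBD {v b : ℕ} (k : ℕ) (blocks : Fin b → Subset v) (P : SubCand v b) : Set where
  field
    isSub   : IsSubBIBD blocks P
    nontriv : k < ∣ proj₁ P ∣
    minimal : ∀ Q → IsSubBIBD blocks Q → k < ∣ proj₁ Q ∣ → ∣ proj₁ P ∣ ≤ ∣ proj₁ Q ∣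

record EnumeratesMinimal {v b : ℕ} (k : ℕ) (blocks : Fin b → Subset v) (subs : List (SubCand v b)) : Set where
  field
    unique   : Unique subs
    complete : ∀ P → (P ∈ subs) ⇔ IsMinimalSubBIBD k blocks P

pointCount : {v b : ℕ} → List (SubCand v b) → Fin v → ℕ
pointCount subs x = length (filter (λ P → T? (lookup (proj₁ P) x)) subs)

blockCount : {v b : ℕ} → List (SubCand v b) → Fin b → ℕ
blockCount subs i = length (filter (λ P → T? (lookup (proj₂ P) i)) subs)

record WellDistributed {v b : ℕ} (subs : List (SubCand v b)) (l m : ℕ) : Set where
  field
    points : ∀ x → pointCount subs x ≡ l
    blocks : ∀ i → blockCount subs i ≡ m

module Submission where

-- Proof by double counting, as in the paper.  A flag is a quadruple
-- (P, x, y, B) where P is one of the n minimal sub-BIBDs, x ≠ y are points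
-- and B is a block of P containing x and y.
--   * Fixing P: P is a (v',k,1)-design, so each of its v'(v'-1) ordered
--     pairs of distinct points lies in exactly one of its blocks, and no
--     other pair lies in any of its blocks; there are n·v'(v'-1) flags.
--   * Fixing (x, y, B): B is the unique block of the design through x and
--     y, and lies in exactly m minimal sub-BIBDs; there are m·v(v-1) flags.
-- This is (a).  Counting the pairs (P, x) with x a point of P in the same
-- two ways gives n·v' = v·l; combining with (a) and cancelling v > 0
-- yields (b).

open import Defs
open import Data.Nat using (ℕ; zero; suc; _+_; _*_; _∸_; z≤n; s≤s; NonZero; >-nonZero)
open import Data.Nat.Properties
  using (+-*-semiring; +-commutativeSemigroup; *-commutativeSemigroup; *-identityˡ; *-identityʳ; *-assoc; *-comm;
         m+n∸m≡n; ≤-trans; *-cancelˡ-≡)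
open import Algebra.Properties.Semiring.Sum +-*-semiring
  using (sum-syntax; sum-cong-≗; ∑-comm; *-distribˡ-sum; *-distribʳ-sum)
open import Algebra.Properties.CommutativeSemigroup +-commutativeSemigroup
  using () renaming (x∙yz≈y∙xz to +-swapˡ)
open import Algebra.Properties.CommutativeSemigroup *-commutativeSemigroup
  using () renaming (x∙yz≈y∙xz to *-swapˡ)
open import Data.Bool using (Bool; true; false; _∧_; if_then_else_)
open import Data.Bool.Properties using (T?; ∧-assoc; ∧-comm)
open import Data.Fin using (Fin; zero; suc; _≟_)
open import Data.Fin.Subset using (Subset; ∣_∣)
open import Data.Vec using (_∷_; []; lookup)
open import Data.Vec.Properties using (lookup⇒[]=; []=⇒lookup)
open import Data.List as List using (List; length; filter; _∷_; [])
open import Data.List.Membership.Propositional using (_∈_)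
open import Data.List.Membership.Propositional.Properties using (∈-lookup)
open import Data.Product using (_×_; _,_; proj₁; proj₂)
open import Relation.Nullary using (yes; no; contradiction)
open import Relation.Binary.PropositionalEquality
  using (_≡_; _≢_; refl; sym; trans; cong; module ≡-Reasoning)
open import Function.Bundles using (Equivalence)

𝟙 : Bool → ℕ
𝟙 b = if b then 1 else 0

𝟙-∧ : ∀ a c → 𝟙 (a ∧ c) ≡ 𝟙 a * 𝟙 c
𝟙-∧ false c = refl
𝟙-∧ true  c = sym (*-identityˡ (𝟙 c))

∑-const : ∀ n c → ∑[ i < n ] c ≡ n * c
∑-const zero    c = refl
∑-const (suc n) c = cong (c +_) (∑-const n c)

countFin≡∑ : ∀ n (p : Fin n → Bool) → countFin n p ≡ ∑[ i < n ] 𝟙 (p i)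
countFin≡∑ zero    p = refl
countFin≡∑ (suc n) p = cong (𝟙 (p zero) +_) (countFin≡∑ n (λ i → p (suc i)))

∣∣≡∑ : ∀ {n} (W : Subset n) → ∣ W ∣ ≡ ∑[ x < n ] 𝟙 (lookup W x)
∣∣≡∑ []          = refl
∣∣≡∑ (true  ∷ W) = cong suc (∣∣≡∑ W)
∣∣≡∑ (false ∷ W) = ∣∣≡∑ W

length-filter≡∑ : {A : Set} (g : A → Bool) (xs : List A) →
  length (filter (λ a → T? (g a)) xs) ≡ ∑[ j < length xs ] 𝟙 (g (List.lookup xs j))
length-filter≡∑ g []       = refl
length-filter≡∑ g (a ∷ xs) with g a
... | true  = cong suc (length-filter≡∑ g xs)
... | false = length-filter≡∑ g xs

countFin-none : ∀ n (p : Fin n → Bool) → (∀ i → p i ≡ false) → countFin n p ≡ 0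
countFin-none zero    p none = refl
countFin-none (suc n) p none
  rewrite none zero = countFin-none n (λ i → p (suc i)) (λ i → none (suc i))

distinct : ∀ {n} → Fin n → Fin n → ℕ
distinct zero    zero    = 0
distinct zero    (suc _) = 1
distinct (suc _) zero    = 1
distinct (suc x) (suc y) = distinct x y

distinct-irrefl : ∀ {n} (x : Fin n) → distinct x x ≡ 0
distinct-irrefl zero    = refl
distinct-irrefl (suc x) = distinct-irrefl x

-- Multiplying by [x ≠ y] only requires agreement of the factors off the
-- diagonal; this is how the pair conditions of Defs (stated for x ≢ y)
-- enter the sums.
distinct-*-cong : ∀ {n} (x y : Fin n) {a c : ℕ} → (x ≢ y → a ≡ c) →
  distinct x y * a ≡ distinct x y * c
distinct-*-cong x y off with x ≟ y
... | yes refl rewrite distinct-irrefl x = refl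
... | no x≢y   = cong (distinct x y *_) (off x≢y)

∑-pick : ∀ {n} (x : Fin n) (g : Fin n → ℕ) →
  ∑[ y < n ] g y ≡ g x + ∑[ y < n ] (distinct x y * g y)
∑-pick zero    g = cong (g zero +_) (sum-cong-≗ (λ y → sym (*-identityˡ (g (suc y)))))
∑-pick (suc x) g = begin
  g zero + ∑[ y < _ ] g (suc y)
    ≡⟨ cong (g zero +_) (∑-pick x (λ y → g (suc y))) ⟩
  g zero + (g (suc x) + ∑[ y < _ ] (distinct x y * g (suc y)))
    ≡⟨ +-swapˡ (g zero) (g (suc x)) _ ⟩
  g (suc x) + (g zero + ∑[ y < _ ] (distinct x y * g (suc y)))
    ≡⟨ cong (λ t → g (suc x) + (t + ∑[ y < _ ] (distinct x y * g (suc y)))) (sym (*-identityˡ (g zero))) ⟩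
  g (suc x) + (1 * g zero + ∑[ y < _ ] (distinct x y * g (suc y))) ∎
  where open ≡-Reasoning

orderedPairs : ∀ n (w : Fin n → Bool) →
  ∑[ x < n ] ∑[ y < n ] (distinct x y * (𝟙 (w x) * 𝟙 (w y)))
    ≡ (∑[ x < n ] 𝟙 (w x)) * ((∑[ x < n ] 𝟙 (w x)) ∸ 1)
orderedPairs n w = begin
  ∑[ x < n ] ∑[ y < n ] (distinct x y * (𝟙 (w x) * 𝟙 (w y)))
    ≡⟨ sum-cong-≗ (λ x → trans (sum-cong-≗ (λ y → *-swapˡ (distinct x y) (𝟙 (w x)) (𝟙 (w y))))
                               (sym (*-distribˡ-sum {n} (𝟙 (w x)) (λ y → distinct x y * 𝟙 (w y))))) ⟩
  ∑[ x < n ] (𝟙 (w x) * ∑[ y < n ] (distinct x y * 𝟙 (w y)))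
    ≡⟨ sum-cong-≗ (λ x → cong (𝟙 (w x) *_) (others x)) ⟩
  ∑[ x < n ] (𝟙 (w x) * (N ∸ 𝟙 (w x)))
    ≡⟨ sum-cong-≗ (λ x → selfExcluded (w x)) ⟩
  ∑[ x < n ] (𝟙 (w x) * (N ∸ 1))
    ≡⟨ sym (*-distribʳ-sum {n} (N ∸ 1) (λ x → 𝟙 (w x))) ⟩
  N * (N ∸ 1) ∎
  where
  open ≡-Reasoning
  N : ℕ
  N = ∑[ x < n ] 𝟙 (w x)
  others : ∀ x → ∑[ y < n ] (distinct x y * 𝟙 (w y)) ≡ N ∸ 𝟙 (w x)
  others x = sym (trans (cong (_∸ 𝟙 (w x)) (∑-pick x (λ y → 𝟙 (w y)))) (m+n∸m≡n (𝟙 (w x)) _))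
  selfExcluded : ∀ c → 𝟙 c * (N ∸ 𝟙 c) ≡ 𝟙 c * (N ∸ 1)
  selfExcluded true  = refl
  selfExcluded false = refl

allOrderedPairs : ∀ n → ∑[ x < n ] ∑[ y < n ] distinct x y ≡ n * (n ∸ 1)
allOrderedPairs n = begin
  ∑[ x < n ] ∑[ y < n ] distinct x y
    ≡⟨ sum-cong-≗ {n} (λ x → sum-cong-≗ {n} (λ y → sym (*-identityʳ (distinct x y)))) ⟩
  ∑[ x < n ] ∑[ y < n ] (distinct x y * 1)
    ≡⟨ orderedPairs n (λ _ → true) ⟩
  N * (N ∸ 1)
    ≡⟨ cong (λ t → t * (t ∸ 1)) (trans (∑-const n 1) (*-identityʳ n)) ⟩
  n * (n ∸ 1) ∎
  where
  open ≡-Reasoning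
  N : ℕ
  N = ∑[ x < n ] 1

module _ {v b : ℕ} (blocks : Fin b → Subset v) where

  pairBlocks : SubCand v b → Fin v → Fin v → ℕ
  pairBlocks P x y =
    countFin b (λ i → lookup (proj₂ P) i ∧ lookup (blocks i) x ∧ lookup (blocks i) y)

  outsideAvoidsBlocks : ∀ {P} → IsSubBIBD blocks P → ∀ {x} → lookup (proj₁ P) x ≡ false →
    ∀ i → lookup (proj₂ P) i ∧ lookup (blocks i) x ≡ false
  outsideAvoidsBlocks {P} sub {x} x∉V' i with lookup (proj₂ P) i in i∈B' | lookup (blocks i) x in x∈Bᵢ
  ... | false | _     = refl
  ... | true  | false = refl
  ... | true  | true  = contradiction (trans (sym x∈V') x∉V') λ ()
    where
    x∈V' : lookup (proj₁ P) x ≡ true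
    x∈V' = []=⇒lookup (IsSubBIBD.blocksInside sub i i∈B' (lookup⇒[]= x (blocks i) x∈Bᵢ))

  subPairBlocks : ∀ {P} → IsSubBIBD blocks P → ∀ x y → x ≢ y →
    pairBlocks P x y ≡ 𝟙 (lookup (proj₁ P) x) * 𝟙 (lookup (proj₁ P) y)
  subPairBlocks {P} sub x y x≢y with lookup (proj₁ P) x in x∈V' | lookup (proj₁ P) y in y∈V'
  ... | true  | true  = IsSubBIBD.balanced sub x y x≢y x∈V' y∈V'
  ... | false | _     = countFin-none b _ λ i →
    trans (sym (∧-assoc (lookup (proj₂ P) i) _ _))
          (cong (_∧ lookup (blocks i) y) (outsideAvoidsBlocks sub x∈V' i))
  ... | true  | false = countFin-none b _ λ i →
    trans (cong (lookup (proj₂ P) i ∧_) (∧-comm (lookup (blocks i) x) _))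
          (trans (sym (∧-assoc (lookup (proj₂ P) i) _ _))
                 (cong (_∧ lookup (blocks i) x) (outsideAvoidsBlocks sub y∈V' i)))

  subFlags : ∀ {P} → IsSubBIBD blocks P →
    ∑[ x < v ] ∑[ y < v ] (distinct x y * pairBlocks P x y) ≡ ∣ proj₁ P ∣ * (∣ proj₁ P ∣ ∸ 1)
  subFlags {P} sub = begin
    ∑[ x < v ] ∑[ y < v ] (distinct x y * pairBlocks P x y)
      ≡⟨ sum-cong-≗ (λ x → sum-cong-≗ (λ y → distinct-*-cong x y (subPairBlocks sub x y))) ⟩
    ∑[ x < v ] ∑[ y < v ] (distinct x y * (𝟙 (lookup V' x) * 𝟙 (lookup V' y)))
      ≡⟨ orderedPairs v (lookup V') ⟩
    N * (N ∸ 1)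
      ≡⟨ cong (λ t → t * (t ∸ 1)) (sym (∣∣≡∑ V')) ⟩
    ∣ V' ∣ * (∣ V' ∣ ∸ 1) ∎
    where
    open ≡-Reasoning
    V' : Subset v
    V' = proj₁ P
    N : ℕ
    N = ∑[ x < v ] 𝟙 (lookup V' x)

  designPairBlocks : ∀ {k} → IsBIBD v k 1 b blocks → ∀ x y →
    distinct x y * countFin b (λ i → lookup (blocks i) x ∧ lookup (blocks i) y) ≡ distinct x y
  designPairBlocks D x y =
    trans (distinct-*-cong x y (IsBIBD.balanced D x y)) (*-identityʳ (distinct x y))

  familyPairBlocks : (subs : List (SubCand v b)) {m : ℕ} → (∀ i → blockCount subs i ≡ m) →
    ∀ x y → ∑[ j < length subs ] pairBlocks (List.lookup subs j) x y
              ≡ m * countFin b (λ i → lookup (blocks i) x ∧ lookup (blocks i) y)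
  familyPairBlocks subs {m} each x y = begin
    ∑[ j < length subs ] pairBlocks (P j) x y
      ≡⟨ sum-cong-≗ (λ j → trans (countFin≡∑ b _) (sum-cong-≗ (λ i → 𝟙-∧ (B' j i) (both i)))) ⟩
    ∑[ j < length subs ] ∑[ i < b ] (𝟙 (B' j i) * 𝟙 (both i))
      ≡⟨ ∑-comm (λ j i → 𝟙 (B' j i) * 𝟙 (both i)) ⟩
    ∑[ i < b ] ∑[ j < length subs ] (𝟙 (B' j i) * 𝟙 (both i))
      ≡⟨ sum-cong-≗ (λ i → sym (*-distribʳ-sum {length subs} (𝟙 (both i)) (λ j → 𝟙 (B' j i)))) ⟩
    ∑[ i < b ] ((∑[ j < length subs ] 𝟙 (B' j i)) * 𝟙 (both i))
      ≡⟨ sum-cong-≗ (λ i → cong (_* 𝟙 (both i)) (blockMultiplicity i)) ⟩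
    ∑[ i < b ] (m * 𝟙 (both i))
      ≡⟨ sym (*-distribˡ-sum {b} m (λ i → 𝟙 (both i))) ⟩
    m * ∑[ i < b ] 𝟙 (both i)
      ≡⟨ cong (m *_) (sym (countFin≡∑ b both)) ⟩
    m * countFin b both ∎
    where
    open ≡-Reasoning
    P : Fin (length subs) → SubCand v b
    P = List.lookup subs
    B' : Fin (length subs) → Fin b → Bool
    B' j = lookup (proj₂ (P j))
    both : Fin b → Bool
    both i = lookup (blocks i) x ∧ lookup (blocks i) y
    blockMultiplicity : ∀ i → ∑[ j < length subs ] 𝟙 (B' j i) ≡ m
    blockMultiplicity i = trans (sym (length-filter≡∑ (λ Q → lookup (proj₂ Q) i) subs)) (each i)

  pointIncidences : (subs : List (SubCand v b)) →
    ∑[ j < length subs ] ∣ proj₁ (List.lookup subs j) ∣ ≡ ∑[ x < v ] pointCount subs x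
  pointIncidences subs = begin
    ∑[ j < length subs ] ∣ V' j ∣
      ≡⟨ sum-cong-≗ (λ j → ∣∣≡∑ (V' j)) ⟩
    ∑[ j < length subs ] ∑[ x < v ] 𝟙 (lookup (V' j) x)
      ≡⟨ ∑-comm (λ j x → 𝟙 (lookup (V' j) x)) ⟩
    ∑[ x < v ] ∑[ j < length subs ] 𝟙 (lookup (V' j) x)
      ≡⟨ sum-cong-≗ (λ x → sym (length-filter≡∑ (λ Q → lookup (proj₁ Q) x) subs)) ⟩
    ∑[ x < v ] pointCount subs x ∎
    where
    open ≡-Reasoning
    V' : Fin (length subs) → Subset v
    V' j = proj₁ (List.lookup subs j)

  uniformPointIncidences : (subs : List (SubCand v b)) {l v' : ℕ} →
    (∀ x → pointCount subs x ≡ l) → (∀ P → P ∈ subs → ∣ proj₁ P ∣ ≡ v') →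
    v * l ≡ length subs * v'
  uniformPointIncidences subs {l} {v'} each order = begin
    v * l                           ≡⟨ sym (∑-const v l) ⟩
    ∑[ x < v ] l                    ≡⟨ sum-cong-≗ (λ x → sym (each x)) ⟩
    ∑[ x < v ] pointCount subs x    ≡⟨ sym (pointIncidences subs) ⟩
    ∑[ j < n ] ∣ proj₁ (List.lookup subs j) ∣
                                    ≡⟨ sum-cong-≗ (λ j → order _ (∈-lookup j)) ⟩
    ∑[ j < n ] v'                   ≡⟨ ∑-const n v' ⟩
    n * v'                          ∎
    where
    open ≡-Reasoning
    n : ℕ
    n = length subs

  flags : List (SubCand v b) → ℕ
  flags subs = ∑[ j < length subs ] ∑[ x < v ] ∑[ y < v ]
                 (distinct x y * pairBlocks (List.lookup subs j) x y)

  flagsByMembers : (subs : List (SubCand v b)) (v' : ℕ) →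
    (∀ P → P ∈ subs → IsSubBIBD blocks P × ∣ proj₁ P ∣ ≡ v') →
    flags subs ≡ length subs * (v' * (v' ∸ 1))
  flagsByMembers subs v' members = trans (sum-cong-≗ memberFlags) (∑-const (length subs) _)
    where
    memberFlags : ∀ j → ∑[ x < v ] ∑[ y < v ] (distinct x y * pairBlocks (List.lookup subs j) x y)
                          ≡ v' * (v' ∸ 1)
    memberFlags j with members (List.lookup subs j) (∈-lookup j)
    ... | sub , refl = subFlags sub

  flagsByPairs : ∀ {k} → IsBIBD v k 1 b blocks → (subs : List (SubCand v b)) {m : ℕ} →
    (∀ i → blockCount subs i ≡ m) → flags subs ≡ m * (v * (v ∸ 1))
  flagsByPairs D subs {m} each = begin
    flags subs
      ≡⟨ ∑-comm (λ j x → ∑[ y < v ] flag j x y) ⟩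
    ∑[ x < v ] ∑[ j < length subs ] ∑[ y < v ] flag j x y
      ≡⟨ sum-cong-≗ (λ x → ∑-comm (λ j y → flag j x y)) ⟩
    ∑[ x < v ] ∑[ y < v ] ∑[ j < length subs ] flag j x y
      ≡⟨ sum-cong-≗ (λ x → sum-cong-≗ (λ y → pairFlags x y)) ⟩
    ∑[ x < v ] ∑[ y < v ] (m * distinct x y)
      ≡⟨ sum-cong-≗ {v} (λ x → sym (*-distribˡ-sum {v} m (distinct x))) ⟩
    ∑[ x < v ] (m * ∑[ y < v ] distinct x y)
      ≡⟨ sym (*-distribˡ-sum {v} m (λ x → ∑[ y < v ] distinct x y)) ⟩
    m * ∑[ x < v ] ∑[ y < v ] distinct x y
      ≡⟨ cong (m *_) (allOrderedPairs v) ⟩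
    m * (v * (v ∸ 1)) ∎
    where
    open ≡-Reasoning
    flag : Fin (length subs) → Fin v → Fin v → ℕ
    flag j x y = distinct x y * pairBlocks (List.lookup subs j) x y
    pairFlags : ∀ x y → ∑[ j < length subs ] flag j x y ≡ m * distinct x y
    pairFlags x y = begin
      ∑[ j < length subs ] flag j x y
        ≡⟨ sym (*-distribˡ-sum {length subs} (distinct x y) (λ j → pairBlocks (List.lookup subs j) x y)) ⟩
      distinct x y * ∑[ j < length subs ] pairBlocks (List.lookup subs j) x y
        ≡⟨ cong (distinct x y *_) (familyPairBlocks subs each x y) ⟩
      distinct x y * (m * countFin b _)
        ≡⟨ *-swapˡ (distinct x y) m _ ⟩
      m * (distinct x y * countFin b _)
        ≡⟨ cong (m *_) (designPairBlocks D x y) ⟩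
      m * distinct x y ∎

replicationFromBlocks : ∀ v l n v' m → .{{_ : NonZero v}} →
  v * l ≡ n * v' → n * (v' * (v' ∸ 1)) ≡ m * (v * (v ∸ 1)) → l * (v' ∸ 1) ≡ m * (v ∸ 1)
replicationFromBlocks v l n v' m incidences pairs = *-cancelˡ-≡ _ _ v (begin
  v * (l * (v' ∸ 1))   ≡⟨ sym (*-assoc v l _) ⟩
  v * l * (v' ∸ 1)     ≡⟨ cong (_* (v' ∸ 1)) incidences ⟩
  n * v' * (v' ∸ 1)    ≡⟨ *-assoc n v' _ ⟩
  n * (v' * (v' ∸ 1))  ≡⟨ pairs ⟩
  m * (v * (v ∸ 1))    ≡⟨ sym (*-assoc m v _) ⟩
  m * v * (v ∸ 1)      ≡⟨ cong (_* (v ∸ 1)) (*-comm m v) ⟩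
  v * m * (v ∸ 1)      ≡⟨ *-assoc v m _ ⟩
  v * (m * (v ∸ 1))    ∎)
  where open ≡-Reasoning

corollary2p6 : (v k b : ℕ) (blocks : Fin b → Subset v) → IsBIBD v k 1 b blocks →
    (subs : List (SubCand v b)) → EnumeratesMinimal k blocks subs →
    (l m : ℕ) → WellDistributed subs l m →
    (v' : ℕ) → (∀ P → P ∈ subs → ∣ proj₁ P ∣ ≡ v') →
    (length subs * (v' * (v' ∸ 1)) ≡ m * (v * (v ∸ 1)))
      × (l * (v' ∸ 1) ≡ m * (v ∸ 1))
corollary2p6 v k b blocks D subs E l m W v' order = partA , partB
  where
  members : ∀ P → P ∈ subs → IsSubBIBD blocks P × ∣ proj₁ P ∣ ≡ v'
  members P P∈ =
    IsMinimalSubBIBD.isSub (Equivalence.to (EnumeratesMinimal.complete E P) P∈) , order P P∈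
  partA : length subs * (v' * (v' ∸ 1)) ≡ m * (v * (v ∸ 1))
  partA = trans (sym (flagsByMembers blocks subs v' members))
                (flagsByPairs blocks D subs (WellDistributed.blocks W))
  partB : l * (v' ∸ 1) ≡ m * (v ∸ 1)
  partB = replicationFromBlocks v l (length subs) v' m
            {{>-nonZero (≤-trans (s≤s z≤n) (IsBIBD.k<v D))}}
            (uniformPointIncidences blocks subs (WellDistributed.points W) order) partA
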